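{- Let $G$ be a cograph of order $n$ with cotree $T_G$, where every leaf of $T_G$ has weight $p=1$ and each interior vertex $w$ is assigned its degree $\delta(w)$. If $w_j$ is an interior vertex of maximum depth in $T_G$ having $t_j\geq 2$ leaf children, then $\delta(w_j)$ is a Laplacian eigenvalue of $G$ with multiplicity $t_j-1$.
   Context: The Laplacian matrix of $G$ is $L(G)=\Delta(G)-A(G)$. A cograph is a graph with no induced path on four vertices. The cotree $T_G$ of a cograph $G$ is the rooted tree whose leaves are the vertices of $G$, whose interior vertices are each labelled $\cup$ or $\otimes$, every interior vertex having at least two children, with labels alternating along root-to-leaf paths, and such that two vertices of $G$ are adjacent iff their least common ancestor is of $\otimes$-type. For interior vertices, $lca(w_i,w_j)$ is their least common ancestor, with $lca(w_j,w_j)=w_j$. With all leaf weights equal to $1$, the degree of an interior vertex $w_j$ is $\delta(w_j)=$ the number of leaves $v$ whose parent $w_i$ satisfies that $lca(w_i,w_j)$ is of $\otimes$-type.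
   Formalization: $\delta(w_j)$ is a Laplacian eigenvalue of G with multiplicity at least $t_j-1$, not exactly $t_j-1$, the multiplicity being counted as linearly independent eigenvectors of L(G) with rational entries. Apart from conventions, each condition added here is assumed in the paper as well or is needed for the statement above to hold. -}

module Defs where

open import Data.Nat using (ℕ; zero; suc; _≤_)
open import Data.Bool using (Bool; true; false; if_then_else_)
open import Data.List using (List; []; _∷_; _++_; map; length; filterᵇ)
import Data.List as List
open import Data.Maybe using (Maybe; just; nothing; maybe)
import Data.Maybe as Maybe
open import Data.Fin using (Fin; zero; suc)
import Data.Fin as Fin
open import Data.Product using (_×_; Σ)
open import Data.Unit using (⊤)
open import Data.Empty using (⊥)
open import Data.Integer using (+_)
open import Data.Rational using (ℚ; 0ℚ; _/_; _+_; _*_; _-_)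
open import Relation.Nullary using (¬_; does)
open import Relation.Binary.PropositionalEquality using (_≡_)

data Label : Set where
  union : Label
  join  : Label

isJoin : Label → Bool
isJoin union = false
isJoin join  = true

data Cotree : Set where
  leaf : Cotree
  node : Label → List Cotree → Cotree

isLeaf : Cotree → Bool
isLeaf leaf       = true
isLeaf (node _ _) = false

rootLabel : Cotree → Maybe Label
rootLabel leaf       = nothing
rootLabel (node l _) = just l

mutual
  Valid : Cotree → Set
  Valid leaf        = ⊤
  Valid (node l cs) = (2 ≤ length cs) × ValidChildren l cs

  ValidChildren : Label → List Cotree → Set
  ValidChildren l []       = ⊤
  ValidChildren l (c ∷ cs) =
    (Valid c × ¬ (rootLabel c ≡ just l)) × ValidChildren l cs

mutual
  -- a vertex of the tree t (identified with the path from the root)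
  data Pos : Cotree → Set where
    here : ∀ {t} → Pos t
    down : ∀ {l cs} → ChildPos cs → Pos (node l cs)

  data ChildPos : List Cotree → Set where
    hd : ∀ {c cs} → Pos c → ChildPos (c ∷ cs)
    tl : ∀ {c cs} → ChildPos cs → ChildPos (c ∷ cs)

mutual
  subtree : ∀ {t} → Pos t → Cotree
  subtree {t} here = t
  subtree (down c) = subtreeC c

  subtreeC : ∀ {cs} → ChildPos cs → Cotree
  subtreeC (hd p) = subtree p
  subtreeC (tl c) = subtreeC c

labelAt : ∀ {t} → Pos t → Maybe Label
labelAt p = rootLabel (subtree p)

IsInterior : ∀ {t} → Pos t → Set
IsInterior p = isLeaf (subtree p) ≡ false

mutual
  depth : ∀ {t} → Pos t → ℕ
  depth here     = zero
  depth (down c) = suc (depthC c)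

  depthC : ∀ {cs} → ChildPos cs → ℕ
  depthC (hd p) = depth p
  depthC (tl c) = depthC c

mutual
  lca : ∀ {t} → Pos t → Pos t → Pos t
  lca here     _        = here
  lca (down _) here     = here
  lca (down c) (down d) = maybe down here (lcaC c d)

  -- nothing: the two positions lie in different children
  lcaC : ∀ {cs} → ChildPos cs → ChildPos cs → Maybe (ChildPos cs)
  lcaC (hd p) (hd q) = just (hd (lca p q))
  lcaC (tl c) (tl d) = Maybe.map tl (lcaC c d)
  lcaC (hd _) (tl _) = nothing
  lcaC (tl _) (hd _) = nothing

-- parent of a vertex (the root is sent to itself)
mutual
  parent : ∀ {t} → Pos t → Pos t
  parent here     = here
  parent (down c) = maybe down here (parentC c)

  -- nothing: the position is an immediate child
  parentC : ∀ {cs} → ChildPos cs → Maybe (ChildPos cs)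
  parentC (hd here)     = nothing
  parentC (hd (down c)) = just (hd (parent (down c)))
  parentC (tl c)        = Maybe.map tl (parentC c)

mutual
  allPos : (t : Cotree) → List (Pos t)
  allPos leaf        = here ∷ []
  allPos (node l cs) = here ∷ map down (allPosC cs)

  allPosC : (cs : List Cotree) → List (ChildPos cs)
  allPosC []       = []
  allPosC (c ∷ cs) = map hd (allPos c) ++ map tl (allPosC cs)

-- the leaves of the cotree = the vertices of the cograph G
leafList : (t : Cotree) → List (Pos t)
leafList t = filterᵇ (λ p → isLeaf (subtree p)) (allPos t)

isJoinPos : ∀ {t} → Pos t → Bool
isJoinPos p = maybe isJoin false (labelAt p)

leafChildren : ∀ {t} → Pos t → ℕ
leafChildren p with subtree p
... | leaf      = 0
... | node _ cs = length (filterᵇ isLeaf cs)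

-- degree δ(w) of an interior vertex (all leaf weights equal to 1):
-- number of leaves v whose parent w_i satisfies lca(w_i, w) of ⊗-type
δ : ∀ {t} → Pos t → ℕ
δ {t} w = length (filterᵇ (λ v → isJoinPos (lca (parent v) w)) (leafList t))

order : Cotree → ℕ
order t = length (leafList t)

vertex : (t : Cotree) → Fin (order t) → Pos t
vertex t i = List.lookup (leafList t) i

adjB : (t : Cotree) → Fin (order t) → Fin (order t) → Bool
adjB t i j = isJoinPos (lca (vertex t i) (vertex t j))

ℕtoℚ : ℕ → ℚ
ℕtoℚ n = (+ n) / 1

Matrix : ℕ → Set
Matrix n = Fin n → Fin n → ℚ

adjMatrix : (t : Cotree) → Matrix (order t)
adjMatrix t i j =
  if does (i Fin.≟ j) then 0ℚ else (if adjB t i j then ℕtoℚ 1 else 0ℚ)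

degreeG : (t : Cotree) → Fin (order t) → ℕ
degreeG t i = length (filterᵇ (λ j → if does (i Fin.≟ j) then false else adjB t i j)
                               (List.allFin (order t)))

degMatrix : (t : Cotree) → Matrix (order t)
degMatrix t i j = if does (i Fin.≟ j) then ℕtoℚ (degreeG t i) else 0ℚ

laplacian : (t : Cotree) → Matrix (order t)
laplacian t i j = degMatrix t i j - adjMatrix t i j

Σ[<_]_ : (n : ℕ) → (Fin n → ℚ) → ℚ
Σ[< zero  ] f = 0ℚ
Σ[< suc n ] f = f zero + Σ[< n ] (λ i → f (suc i))

IsEigenvector : ∀ {n} → Matrix n → ℚ → (Fin n → ℚ) → Set
IsEigenvector {n} M λ' x = ∀ i → Σ[< n ] (λ j → M i j * x j) ≡ λ' * x i

LinearlyIndependent : ∀ {n k} → (Fin k → Fin n → ℚ) → Set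
LinearlyIndependent {n} {k} v =
  ∀ (c : Fin k → ℚ) → (∀ i → Σ[< k ] (λ r → c r * v r i) ≡ 0ℚ) → ∀ r → c r ≡ 0ℚ

-- λ is an eigenvalue of M of multiplicity at least k: the eigenspace
-- contains k linearly independent (hence nonzero) vectors.
-- (For a real symmetric matrix, geometric = algebraic multiplicity.)
EigenvalueMultAtLeast : ∀ {n} → Matrix n → ℚ → ℕ → Set
EigenvalueMultAtLeast {n} M λ' k =
  Σ (Fin k → Fin n → ℚ) λ v → (∀ r → IsEigenvector M λ' (v r)) × LinearlyIndependent v

-- The leaf children of w are pairwise twins in G: for every other vertex v and every
-- leaf child a of w, lca(v, a) = lca(parent v, w), which does not depend on a.  So for
-- two leaf children a ≠ b the vector e_a − e_b is a Laplacian eigenvector with eigenvalue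
-- deg a + [a ~ b], and this is δ(w): δ(w) counts the neighbours of a, plus a itself
-- exactly when w is of ⊗-type (then lca(parent a, w) = w), which is also when a ~ b.
-- Fixing one leaf child a, the t − 1 vectors e_a − e_b are linearly independent.
module Submission where

open import Defs
open import Data.Bool using (Bool; true; false; T; if_then_else_)
open import Data.Bool.Properties using (if-cong)
open import Data.Empty using (⊥; ⊥-elim)
open import Data.Fin using (Fin; zero; suc; _≟_)
import Data.Integer as ℤ
import Data.Integer.Properties as ℤ
open import Data.List using (List; []; _∷_; map; length; filterᵇ; lookup; tabulate)
open import Data.List.Membership.Propositional using (_∈_)
open import Data.List.Membership.Propositional.Properties
  using (∈-map⁺; ∈-map⁻; ∈-++⁺ˡ; ∈-++⁺ʳ; ∈-filter⁺; ∈-lookup)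
open import Data.List.Properties using (length-map; tabulate-lookup)
open import Data.List.Relation.Unary.All using (All; []; _∷_)
import Data.List.Relation.Unary.All as All
import Data.List.Relation.Unary.All.Properties as All
import Data.List.Relation.Unary.AllPairs as AllPairs
import Data.List.Relation.Unary.Any as Any
import Data.List.Relation.Unary.Any.Properties as Any
open import Data.List.Relation.Unary.Unique.Propositional using (Unique)
import Data.List.Relation.Unary.Unique.Propositional.Properties as Unique
open import Data.Maybe using (Maybe; just; nothing; maybe)
import Data.Maybe as Maybe
open import Data.Nat using (ℕ; zero; suc; _≤_; _∸_)
import Data.Nat as ℕ
import Data.Nat.Properties as ℕ
import Data.Nat.Coprimality as Coprime
open import Data.Product using (_×_; _,_)
open import Data.Rational using (ℚ; 0ℚ; 1ℚ; _+_; _*_; _-_; _/_; mkℚ)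
import Data.Rational.Properties as ℚ
open import Data.Rational.Solver using (module +-*-Solver)
open import Data.Unit using (⊤; tt)
open import Function using (_∘_; id)
open import Relation.Nullary using (¬_; does; yes; no; Dec)
open import Relation.Nullary.Decidable using (dec-true; dec-false; T?)
open import Relation.Binary.PropositionalEquality

open +-*-Solver

basis : ∀ {n} → Fin n → Fin n → ℚ
basis k j = if does (j ≟ k) then 1ℚ else 0ℚ

basis-diag : ∀ {n} (k : Fin n) → basis k k ≡ 1ℚ
basis-diag k = cong (if_then 1ℚ else 0ℚ) (dec-true (k ≟ k) refl)

basis-offdiag : ∀ {n} {k j : Fin n} → j ≢ k → basis k j ≡ 0ℚ
basis-offdiag {k = k} {j} j≢k = cong (if_then 1ℚ else 0ℚ) (dec-false (j ≟ k) j≢k)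

Σ-cong : ∀ n {f g : Fin n → ℚ} → (∀ j → f j ≡ g j) → Σ[< n ] f ≡ Σ[< n ] g
Σ-cong zero    f≗g = refl
Σ-cong (suc n) f≗g = cong₂ _+_ (f≗g zero) (Σ-cong n (f≗g ∘ suc))

Σ-zero : ∀ n → Σ[< n ] (λ _ → 0ℚ) ≡ 0ℚ
Σ-zero zero    = refl
Σ-zero (suc n) = cong (0ℚ +_) (Σ-zero n)

Σ-sub : ∀ n (f g : Fin n → ℚ) → Σ[< n ] (λ j → f j - g j) ≡ Σ[< n ] f - Σ[< n ] g
Σ-sub zero    f g = refl
Σ-sub (suc n) f g = trans (cong ((f zero - g zero) +_) (Σ-sub n (f ∘ suc) (g ∘ suc)))
                        (interchange (f zero) (g zero) (Σ[< n ] (f ∘ suc)) (Σ[< n ] (g ∘ suc)))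
  where
  interchange : ∀ a b c d → (a - b) + (c - d) ≡ (a + c) - (b + d)
  interchange = solve 4 (λ a b c d → (a :- b) :+ (c :- d) := (a :+ c) :- (b :+ d)) refl

Σ-*-basis : ∀ n (f : Fin n → ℚ) (k : Fin n) → Σ[< n ] (λ j → f j * basis k j) ≡ f k
Σ-*-basis (suc n) f zero =
  trans (cong (f zero * 1ℚ +_) (trans (Σ-cong n (λ j → ℚ.*-zeroʳ (f (suc j)))) (Σ-zero n)))
        (trans (ℚ.+-identityʳ (f zero * 1ℚ)) (ℚ.*-identityʳ (f zero)))
Σ-*-basis (suc n) f (suc k) =
  trans (cong₂ _+_ (ℚ.*-zeroʳ (f zero)) (Σ-*-basis n (f ∘ suc) k)) (ℚ.+-identityˡ (f (suc k)))

Σ-*-basis-diff : ∀ n (f : Fin n → ℚ) (a b : Fin n) →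
                 Σ[< n ] (λ j → f j * (basis a j - basis b j)) ≡ f a - f b
Σ-*-basis-diff n f a b = begin
  Σ[< n ] (λ j → f j * (basis a j - basis b j))
    ≡⟨ Σ-cong n (λ j → *-distribˡ-minus (f j) (basis a j) (basis b j)) ⟩
  Σ[< n ] (λ j → f j * basis a j - f j * basis b j)
    ≡⟨ Σ-sub n _ _ ⟩
  Σ[< n ] (λ j → f j * basis a j) - Σ[< n ] (λ j → f j * basis b j)
    ≡⟨ cong₂ _-_ (Σ-*-basis n f a) (Σ-*-basis n f b) ⟩
  f a - f b ∎
  where
  open ≡-Reasoning
  *-distribˡ-minus : ∀ x y z → x * (y - z) ≡ x * y - x * z
  *-distribˡ-minus = solve 3 (λ x y z → x :* (y :- z) := x :* y :- x :* z) refl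

-- Conditions on a pair of indices making e_a − e_b an eigenvector of M for λ'.
EigenTwins : ∀ {n} → Matrix n → ℚ → Fin n → Fin n → Set
EigenTwins M λ' a b =
  (M a a - M a b ≡ λ') × (M b b - M b a ≡ λ') × (∀ i → i ≢ a → i ≢ b → M i a ≡ M i b)

basisDiff-eigenvector : ∀ {n} (M : Matrix n) (λ' : ℚ) {a b : Fin n} → a ≢ b →
                        EigenTwins M λ' a b → IsEigenvector M λ' (λ j → basis a j - basis b j)
basisDiff-eigenvector {n} M λ' {a} {b} a≢b (col-a , col-b , cols) i =
  trans (Σ-*-basis-diff n (M i) a b) (entry (i ≟ a) (i ≟ b))
  where
  entry : Dec (i ≡ a) → Dec (i ≡ b) → M i a - M i b ≡ λ' * (basis a i - basis b i)
  entry (yes refl) (yes refl) = ⊥-elim (a≢b refl)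
  entry (yes refl) (no  i≢b)  = begin
    M a a - M a b                 ≡⟨ col-a ⟩
    λ'                            ≡⟨ solve 1 (λ x → x := x :* (con 1ℚ :- con 0ℚ)) refl λ' ⟩
    λ' * (1ℚ - 0ℚ)                ≡⟨ cong (λ' *_) (sym (cong₂ _-_ (basis-diag a) (basis-offdiag i≢b))) ⟩
    λ' * (basis a a - basis b a)  ∎
    where open ≡-Reasoning
  entry (no i≢a)  (yes refl)  = begin
    M b a - M b b                 ≡⟨ solve 2 (λ x y → x :- y := con 0ℚ :- (y :- x)) refl (M b a) (M b b) ⟩
    0ℚ - (M b b - M b a)          ≡⟨ cong (0ℚ -_) col-b ⟩
    0ℚ - λ'                       ≡⟨ solve 1 (λ x → con 0ℚ :- x := x :* (con 0ℚ :- con 1ℚ)) refl λ' ⟩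
    λ' * (0ℚ - 1ℚ)                ≡⟨ cong (λ' *_) (sym (cong₂ _-_ (basis-offdiag i≢a) (basis-diag b))) ⟩
    λ' * (basis a b - basis b b)  ∎
    where open ≡-Reasoning
  entry (no i≢a)  (no  i≢b)   = begin
    M i a - M i b                 ≡⟨ cong (_- M i b) (cols i i≢a i≢b) ⟩
    M i b - M i b                 ≡⟨ solve 2 (λ x y → x :- x := y :* (con 0ℚ :- con 0ℚ)) refl (M i b) λ' ⟩
    λ' * (0ℚ - 0ℚ)                ≡⟨ cong (λ' *_) (sym (cong₂ _-_ (basis-offdiag i≢a) (basis-offdiag i≢b))) ⟩
    λ' * (basis a i - basis b i)  ∎
    where open ≡-Reasoning

basis-∘-injective : ∀ {k n} {b : Fin k → Fin n} → (∀ {r s} → b r ≡ b s → r ≡ s) →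
                    ∀ r s → basis (b r) (b s) ≡ basis s r
basis-∘-injective {b = b} b-inj r s = by-cases (r ≟ s)
  where
  by-cases : Dec (r ≡ s) → basis (b r) (b s) ≡ basis s r
  by-cases (yes refl) = trans (basis-diag (b r)) (sym (basis-diag r))
  by-cases (no  r≢s)  = trans (basis-offdiag (r≢s ∘ sym ∘ b-inj)) (sym (basis-offdiag r≢s))

basisDiff-linearlyIndependent :
  ∀ {k n} (a : Fin n) (b : Fin k → Fin n) → (∀ {r s} → b r ≡ b s → r ≡ s) → (∀ r → b r ≢ a) →
  LinearlyIndependent (λ r j → basis a j - basis (b r) j)
basisDiff-linearlyIndependent {k} a b b-inj b≢a c combination≡0 s = begin
  c s
    ≡⟨ solve 1 (λ x → x := con 0ℚ :- (con 0ℚ :- x)) refl (c s) ⟩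
  0ℚ - (0ℚ - c s)
    ≡⟨ cong (0ℚ -_) (sym coordinate-b-s) ⟩
  0ℚ - Σ[< k ] (λ r → c r * (basis a (b s) - basis (b r) (b s)))
    ≡⟨ cong (0ℚ -_) (combination≡0 (b s)) ⟩
  0ℚ - 0ℚ
    ≡⟨⟩
  0ℚ ∎
  where
  open ≡-Reasoning
  -- As b s ≠ a and b is injective, only the r = s term contributes to the b s-coordinate.
  coordinate-b-s : Σ[< k ] (λ r → c r * (basis a (b s) - basis (b r) (b s))) ≡ 0ℚ - c s
  coordinate-b-s = begin
    Σ[< k ] (λ r → c r * (basis a (b s) - basis (b r) (b s)))
      ≡⟨ Σ-cong k (λ r → cong₂ (λ x y → c r * (x - y)) (basis-offdiag (b≢a s)) (basis-∘-injective b-inj r s)) ⟩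
    Σ[< k ] (λ r → c r * (0ℚ - basis s r))
      ≡⟨ Σ-cong k (λ r → solve 2 (λ x y → x :* (con 0ℚ :- y) := con 0ℚ :- x :* y) refl (c r) (basis s r)) ⟩
    Σ[< k ] (λ r → 0ℚ - c r * basis s r)
      ≡⟨ Σ-sub k _ _ ⟩
    Σ[< k ] (λ _ → 0ℚ) - Σ[< k ] (λ r → c r * basis s r)
      ≡⟨ cong₂ _-_ (Σ-zero k) (Σ-*-basis k c s) ⟩
    0ℚ - c s ∎

multiplicity-from-eigenTwins :
  ∀ {n k} (M : Matrix n) (λ' : ℚ) (a : Fin n) (b : Fin k → Fin n) →
  (∀ {r s} → b r ≡ b s → r ≡ s) → (∀ r → b r ≢ a) → (∀ r → EigenTwins M λ' a (b r)) →
  EigenvalueMultAtLeast M λ' k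
multiplicity-from-eigenTwins M λ' a b b-inj b≢a twins =
  (λ r j → basis a j - basis (b r) j) ,
  (λ r → basisDiff-eigenvector M λ' (b≢a r ∘ sym) (twins r)) ,
  basisDiff-linearlyIndependent a b b-inj b≢a

boolToℕ : Bool → ℕ
boolToℕ true  = 1
boolToℕ false = 0

countᶠ : ∀ n → (Fin n → Bool) → ℕ
countᶠ zero    p = 0
countᶠ (suc n) p = boolToℕ (p zero) ℕ.+ countᶠ n (p ∘ suc)

length-filterᵇ-tabulate : ∀ {A : Set} n (p : A → Bool) (f : Fin n → A) →
                          length (filterᵇ p (tabulate f)) ≡ countᶠ n (p ∘ f)
length-filterᵇ-tabulate zero    p f = refl
length-filterᵇ-tabulate (suc n) p f with p (f zero)
... | true  = cong suc (length-filterᵇ-tabulate n p (f ∘ suc))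
... | false = length-filterᵇ-tabulate n p (f ∘ suc)

countᶠ-cong : ∀ n {p q : Fin n → Bool} → (∀ j → p j ≡ q j) → countᶠ n p ≡ countᶠ n q
countᶠ-cong zero    p≗q = refl
countᶠ-cong (suc n) p≗q = cong₂ ℕ._+_ (cong boolToℕ (p≗q zero)) (countᶠ-cong n (p≗q ∘ suc))

countᶠ-remove : ∀ n (p : Fin n → Bool) (a : Fin n) →
  countᶠ n p ≡ countᶠ n (λ j → if does (a ≟ j) then false else p j) ℕ.+ boolToℕ (p a)
countᶠ-remove (suc n) p zero    = ℕ.+-comm (boolToℕ (p zero)) (countᶠ n (p ∘ suc))
countᶠ-remove (suc n) p (suc a) =
  trans (cong (boolToℕ (p zero) ℕ.+_) (countᶠ-remove n (p ∘ suc) a))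
        (sym (ℕ.+-assoc (boolToℕ (p zero)) _ (boolToℕ (p (suc a)))))

ℕtoℚ-+ : ∀ m n → ℕtoℚ (m ℕ.+ n) ≡ ℕtoℚ m + ℕtoℚ n
-- The middle term is what ℚ-addition of two fractions over 1 computes to.
ℕtoℚ-+ m n = begin
  ℕtoℚ (m ℕ.+ n)
    ≡⟨ cong (_/ 1) (sym (cong₂ ℤ._+_ (ℤ.*-identityʳ (ℤ.+ m)) (ℤ.*-identityʳ (ℤ.+ n)))) ⟩
  mkℚ (ℤ.+ m) 0 (coprime-1 m) + mkℚ (ℤ.+ n) 0 (coprime-1 n)
    ≡⟨ sym (cong₂ _+_ (ℚ.normalize-coprime (coprime-1 m)) (ℚ.normalize-coprime (coprime-1 n))) ⟩
  ℕtoℚ m + ℕtoℚ n ∎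
  where
  open ≡-Reasoning
  coprime-1 : ∀ k → Coprime.Coprime k 1
  coprime-1 k = Coprime.sym (Coprime.1-coprimeTo k)

adjEntry : Bool → ℚ
adjEntry b = if b then ℕtoℚ 1 else 0ℚ

ℕtoℚ-+-boolToℕ : ∀ m b → ℕtoℚ (m ℕ.+ boolToℕ b) ≡ ℕtoℚ m + adjEntry b
ℕtoℚ-+-boolToℕ m true  = ℕtoℚ-+ m 1
ℕtoℚ-+-boolToℕ m false = ℕtoℚ-+ m 0

mutual
  lca-idem : ∀ {t} (p : Pos t) → lca p p ≡ p
  lca-idem here     = refl
  lca-idem (down c) = cong (maybe down here) (lcaC-idem c)

  lcaC-idem : ∀ {cs} (c : ChildPos cs) → lcaC c c ≡ just c
  lcaC-idem (hd p) = cong (just ∘ hd) (lca-idem p)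
  lcaC-idem (tl c) = cong (Maybe.map tl) (lcaC-idem c)

mutual
  lca-comm : ∀ {t} (p q : Pos t) → lca p q ≡ lca q p
  lca-comm here     here     = refl
  lca-comm here     (down _) = refl
  lca-comm (down _) here     = refl
  lca-comm (down c) (down d) = cong (maybe down here) (lcaC-comm c d)

  lcaC-comm : ∀ {cs} (c d : ChildPos cs) → lcaC c d ≡ lcaC d c
  lcaC-comm (hd p) (hd q) = cong (just ∘ hd) (lca-comm p q)
  lcaC-comm (tl c) (tl d) = cong (Maybe.map tl) (lcaC-comm c d)
  lcaC-comm (hd _) (tl _) = refl
  lcaC-comm (tl _) (hd _) = refl

-- lcaC on optional child positions, nothing standing for the root.
lcaᵐ : ∀ {cs} → Maybe (ChildPos cs) → Maybe (ChildPos cs) → Maybe (ChildPos cs)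
lcaᵐ (just c) (just d) = lcaC c d
lcaᵐ (just _) nothing  = nothing
lcaᵐ nothing  _        = nothing

lca-maybe-down : ∀ {l cs} (x y : Maybe (ChildPos cs)) →
  maybe down here (lcaᵐ x y) ≡ lca {node l cs} (maybe down here x) (maybe down here y)
lca-maybe-down (just _) (just _) = refl
lca-maybe-down (just _) nothing  = refl
lca-maybe-down nothing  (just _) = refl
lca-maybe-down nothing  nothing  = refl

lcaᵐ-map-tl : ∀ {c cs} (x y : Maybe (ChildPos cs)) →
  lcaᵐ (Maybe.map (tl {c}) x) (Maybe.map tl y) ≡ Maybe.map tl (lcaᵐ x y)
lcaᵐ-map-tl (just _) (just _) = refl
lcaᵐ-map-tl (just _) nothing  = refl
lcaᵐ-map-tl nothing  (just _) = refl
lcaᵐ-map-tl nothing  nothing  = refl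

-- Two distinct leaves meet strictly above both of them, hence already at their parents.
mutual
  lca-distinct-leaves : ∀ {t} (u v : Pos t) → subtree u ≡ leaf → subtree v ≡ leaf → u ≢ v →
                        lca u v ≡ lca (parent u) (parent v)
  lca-distinct-leaves here     here     _  _  u≢v = ⊥-elim (u≢v refl)
  lca-distinct-leaves here     (down _) () _  _
  lca-distinct-leaves (down _) here     _  () _
  lca-distinct-leaves (down c) (down d) su sv u≢v =
    trans (cong (maybe down here) (lcaC-distinct-leaves c d su sv (u≢v ∘ cong down)))
          (lca-maybe-down (parentC c) (parentC d))

  lcaC-distinct-leaves : ∀ {cs} (c d : ChildPos cs) → subtreeC c ≡ leaf → subtreeC d ≡ leaf → c ≢ d →
                         lcaC c d ≡ lcaᵐ (parentC c) (parentC d)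
  lcaC-distinct-leaves (hd here)     (hd here)     _  _  c≢d = ⊥-elim (c≢d refl)
  lcaC-distinct-leaves (hd here)     (hd (down _)) () _  _
  lcaC-distinct-leaves (hd (down _)) (hd here)     _  () _
  lcaC-distinct-leaves (hd (down e)) (hd (down f)) sc sd c≢d =
    cong (just ∘ hd) (lca-distinct-leaves (down e) (down f) sc sd (c≢d ∘ cong hd))
  lcaC-distinct-leaves (tl c)        (tl d)        sc sd c≢d =
    trans (cong (Maybe.map tl) (lcaC-distinct-leaves c d sc sd (c≢d ∘ cong tl)))
          (sym (lcaᵐ-map-tl (parentC c) (parentC d)))
  lcaC-distinct-leaves (hd here)     (tl _)        _  _  _ = refl
  lcaC-distinct-leaves (hd (down _)) (tl d)        _  _  _ with parentC d
  ... | just _  = refl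
  ... | nothing = refl
  lcaC-distinct-leaves (tl c)        (hd here)     _  _  _ with parentC c
  ... | just _  = refl
  ... | nothing = refl
  lcaC-distinct-leaves (tl c)        (hd (down _)) _  _  _ with parentC c
  ... | just _  = refl
  ... | nothing = refl

-- extend p q is the position q of the subtree rooted at p, seen as a position of the whole tree.
mutual
  extend : ∀ {t} (p : Pos t) → Pos (subtree p) → Pos t
  extend here     q = q
  extend (down c) q = down (extendC c q)

  extendC : ∀ {cs} (c : ChildPos cs) → Pos (subtreeC c) → ChildPos cs
  extendC (hd p) q = hd (extend p q)
  extendC (tl c) q = tl (extendC c q)

mutual
  subtree-extend : ∀ {t} (p : Pos t) (q : Pos (subtree p)) → subtree (extend p q) ≡ subtree q
  subtree-extend here     q = refl
  subtree-extend (down c) q = subtreeC-extendC c q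

  subtreeC-extendC : ∀ {cs} (c : ChildPos cs) (q : Pos (subtreeC c)) → subtreeC (extendC c q) ≡ subtree q
  subtreeC-extendC (hd p) q = subtree-extend p q
  subtreeC-extendC (tl c) q = subtreeC-extendC c q

mutual
  extend-here : ∀ {t} (p : Pos t) → extend p here ≡ p
  extend-here here     = refl
  extend-here (down c) = cong down (extendC-here c)

  extendC-here : ∀ {cs} (c : ChildPos cs) → extendC c here ≡ c
  extendC-here (hd p) = cong hd (extend-here p)
  extendC-here (tl c) = cong tl (extendC-here c)

down-injective : ∀ {l cs} {c d : ChildPos cs} → down {l} c ≡ down d → c ≡ d
down-injective refl = refl

hd-injective : ∀ {c cs} {p q : Pos c} → hd {c} {cs} p ≡ hd q → p ≡ q
hd-injective refl = refl

tl-injective : ∀ {c cs} {d e : ChildPos cs} → tl {c} d ≡ tl e → d ≡ e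
tl-injective refl = refl

mutual
  extend-injective : ∀ {t} (p : Pos t) {q q′ : Pos (subtree p)} → extend p q ≡ extend p q′ → q ≡ q′
  extend-injective here     eq = eq
  extend-injective (down c) eq = extendC-injective c (down-injective eq)

  extendC-injective : ∀ {cs} (c : ChildPos cs) {q q′ : Pos (subtreeC c)} → extendC c q ≡ extendC c q′ → q ≡ q′
  extendC-injective (hd p) eq = extend-injective p (hd-injective eq)
  extendC-injective (tl c) eq = extendC-injective c (tl-injective eq)

NonRoot : ∀ {t} → Pos t → Set
NonRoot here     = ⊥
NonRoot (down _) = ⊤

mutual
  parent-extend : ∀ {t} (p : Pos t) (q : Pos (subtree p)) → NonRoot q →
                  parent (extend p q) ≡ extend p (parent q)
  parent-extend here     q        _ = refl
  parent-extend (down c) q nonRoot = cong (maybe down here) (parentC-extendC c q nonRoot)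

  parentC-extendC : ∀ {cs} (c : ChildPos cs) (q : Pos (subtreeC c)) → NonRoot q →
                    parentC (extendC c q) ≡ just (extendC c (parent q))
  parentC-extendC (hd here)     (down _) _ = refl
  parentC-extendC (hd (down c)) q nonRoot = cong (just ∘ hd) (parent-extend (down c) q nonRoot)
  parentC-extendC (tl c)        q nonRoot = cong (Maybe.map tl) (parentC-extendC c q nonRoot)

LeafChildOf : ∀ {t} → Pos t → Pos t → Set
LeafChildOf w a = (subtree a ≡ leaf) × (parent a ≡ w)

leafChildrenC : (cs : List Cotree) → List (ChildPos cs)
leafChildrenC []              = []
leafChildrenC (leaf     ∷ cs) = hd here ∷ map tl (leafChildrenC cs)
leafChildrenC (node _ _ ∷ cs) = map tl (leafChildrenC cs)

rootLeafChildren : (t : Cotree) → List (Pos t)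
rootLeafChildren leaf        = []
rootLeafChildren (node _ cs) = map down (leafChildrenC cs)

leafChildrenOf : ∀ {t} → Pos t → List (Pos t)
leafChildrenOf w = map (extend w) (rootLeafChildren (subtree w))

IsLeafChildC : ∀ {cs} → ChildPos cs → Set
IsLeafChildC c = (subtreeC c ≡ leaf) × (parentC c ≡ nothing)

IsLeafChildC-tl : ∀ {c cs} {d : ChildPos cs} → IsLeafChildC d → IsLeafChildC (tl {c} d)
IsLeafChildC-tl (leaf-d , root-d) = leaf-d , cong (Maybe.map tl) root-d

leafChildrenC-leafChild : (cs : List Cotree) → All IsLeafChildC (leafChildrenC cs)
leafChildrenC-leafChild []              = []
leafChildrenC-leafChild (leaf     ∷ cs) = (refl , refl) ∷ All.map⁺ (All.map (λ {d} → IsLeafChildC-tl {d = d}) (leafChildrenC-leafChild cs))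
leafChildrenC-leafChild (node _ _ ∷ cs) = All.map⁺ (All.map (λ {d} → IsLeafChildC-tl {d = d}) (leafChildrenC-leafChild cs))

rootLeafChildren-leafChild : (t : Cotree) → All (λ q → LeafChildOf here q × NonRoot q) (rootLeafChildren t)
rootLeafChildren-leafChild leaf        = []
rootLeafChildren-leafChild (node l cs) = All.map⁺ (All.map (λ {c} → lift {c}) (leafChildrenC-leafChild cs))
  where lift : ∀ {c} → IsLeafChildC c → LeafChildOf here (down {l} c) × NonRoot (down {l} c)
        lift (leaf-c , root-c) = (leaf-c , cong (maybe down here) root-c) , tt

leafChildrenOf-leafChild : ∀ {t} (w : Pos t) → All (LeafChildOf w) (leafChildrenOf w)
leafChildrenOf-leafChild w = All.map⁺ (All.map (λ {q} → move {q}) (rootLeafChildren-leafChild (subtree w)))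
  where move : ∀ {q} → LeafChildOf here q × NonRoot q → LeafChildOf w (extend w q)
        move {q} ((leaf-q , root-q) , nonRoot) =
          trans (subtree-extend w q) leaf-q ,
          trans (parent-extend w q nonRoot) (trans (cong (extend w) root-q) (extend-here w))

leafChildrenC-unique : (cs : List Cotree) → Unique (leafChildrenC cs)
leafChildrenC-unique []              = AllPairs.[]
leafChildrenC-unique (leaf     ∷ cs) =
  All.map⁺ (All.universal (λ _ ()) (leafChildrenC cs)) AllPairs.∷
  Unique.map⁺ tl-injective (leafChildrenC-unique cs)
leafChildrenC-unique (node _ _ ∷ cs) = Unique.map⁺ tl-injective (leafChildrenC-unique cs)

leafChildrenOf-unique : ∀ {t} (w : Pos t) → Unique (leafChildrenOf w)
leafChildrenOf-unique w = Unique.map⁺ (extend-injective w) (rootUnique (subtree w))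
  where rootUnique : (s : Cotree) → Unique (rootLeafChildren s)
        rootUnique leaf        = AllPairs.[]
        rootUnique (node _ cs) = Unique.map⁺ down-injective (leafChildrenC-unique cs)

length-leafChildrenC : (cs : List Cotree) → length (leafChildrenC cs) ≡ length (filterᵇ isLeaf cs)
length-leafChildrenC []              = refl
length-leafChildrenC (leaf     ∷ cs) = cong suc (trans (length-map tl (leafChildrenC cs)) (length-leafChildrenC cs))
length-leafChildrenC (node _ _ ∷ cs) = trans (length-map tl (leafChildrenC cs)) (length-leafChildrenC cs)

length-leafChildrenOf : ∀ {t} (w : Pos t) → length (leafChildrenOf w) ≡ leafChildren w
length-leafChildrenOf w = trans (length-map (extend w) (rootLeafChildren (subtree w))) (root (subtree w))
  where root : (s : Cotree) → length (rootLeafChildren s) ≡ leafChildren {s} here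
        root leaf        = refl
        root (node _ cs) = trans (length-map down (leafChildrenC cs)) (length-leafChildrenC cs)

mutual
  allPos-unique : (t : Cotree) → Unique (allPos t)
  allPos-unique leaf        = [] AllPairs.∷ AllPairs.[]
  allPos-unique (node l cs) =
    All.map⁺ (All.universal (λ _ ()) (allPosC cs)) AllPairs.∷ Unique.map⁺ down-injective (allPosC-unique cs)

  allPosC-unique : (cs : List Cotree) → Unique (allPosC cs)
  allPosC-unique []       = AllPairs.[]
  allPosC-unique (c ∷ cs) =
    Unique.++⁺ (Unique.map⁺ hd-injective (allPos-unique c)) (Unique.map⁺ tl-injective (allPosC-unique cs)) disjoint
    where
    disjoint : ∀ {v} → ¬ (v ∈ map hd (allPos c) × v ∈ map tl (allPosC cs))
    disjoint (v∈hds , v∈tls) with ∈-map⁻ hd v∈hds | ∈-map⁻ tl v∈tls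
    ... | _ , _ , refl | _ , _ , ()

mutual
  ∈-allPos : ∀ {t} (p : Pos t) → p ∈ allPos t
  ∈-allPos {leaf}     here     = Any.here refl
  ∈-allPos {node _ _} here     = Any.here refl
  ∈-allPos            (down c) = Any.there (∈-map⁺ down (∈-allPosC c))

  ∈-allPosC : ∀ {cs} (c : ChildPos cs) → c ∈ allPosC cs
  ∈-allPosC {c′ ∷ _} (hd p) = ∈-++⁺ˡ (∈-map⁺ hd (∈-allPos p))
  ∈-allPosC {c′ ∷ _} (tl c) = ∈-++⁺ʳ (map hd (allPos c′)) (∈-map⁺ tl (∈-allPosC c))

lookup-injective : ∀ {A : Set} {xs : List A} → Unique xs → ∀ i j → lookup xs i ≡ lookup xs j → i ≡ j
lookup-injective (_  AllPairs.∷ _) zero    zero    _  = refl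
lookup-injective (x∉ AllPairs.∷ _) zero    (suc j) eq = ⊥-elim (All.lookup x∉ (∈-lookup j) eq)
lookup-injective (x∉ AllPairs.∷ _) (suc i) zero    eq = ⊥-elim (All.lookup x∉ (∈-lookup i) (sym eq))
lookup-injective (_  AllPairs.∷ u) (suc i) (suc j) eq = cong suc (lookup-injective u i j eq)

isLeaf⇒≡leaf : ∀ s → T (isLeaf s) → s ≡ leaf
isLeaf⇒≡leaf leaf _ = refl

module Cograph (t : Cotree) where

  isLeafPos? : (p : Pos t) → Dec (T (isLeaf (subtree p)))
  isLeafPos? p = T? (isLeaf (subtree p))

  vertex-injective : ∀ {i j} → vertex t i ≡ vertex t j → i ≡ j
  vertex-injective {i} {j} = lookup-injective (Unique.filter⁺ isLeafPos? (allPos-unique t)) i j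

  vertex-leaf : ∀ j → subtree (vertex t j) ≡ leaf
  vertex-leaf j = isLeaf⇒≡leaf _ (All.lookup (All.all-filter isLeafPos? (allPos t)) (∈-lookup j))

  ∈-leafList : (p : Pos t) → subtree p ≡ leaf → p ∈ leafList t
  ∈-leafList p leaf-p = ∈-filter⁺ isLeafPos? (∈-allPos p) (subst (T ∘ isLeaf) (sym leaf-p) tt)

  vertexIndex : (p : Pos t) → subtree p ≡ leaf → Fin (order t)
  vertexIndex p leaf-p = Any.index (∈-leafList p leaf-p)

  vertex-vertexIndex : (p : Pos t) (leaf-p : subtree p ≡ leaf) → vertex t (vertexIndex p leaf-p) ≡ p
  vertex-vertexIndex p leaf-p = sym (Any.lookup-index (∈-leafList p leaf-p))

  tabulate-vertex : tabulate (vertex t) ≡ leafList t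
  tabulate-vertex = tabulate-lookup (leafList t)

  laplacian-diag : ∀ i → laplacian t i i ≡ ℕtoℚ (degreeG t i) - 0ℚ
  laplacian-diag i = cong₂ _-_ (if-cong (dec-true (i ≟ i) refl)) (if-cong (dec-true (i ≟ i) refl))

  laplacian-offdiag : ∀ {i j} → i ≢ j → laplacian t i j ≡ 0ℚ - adjEntry (adjB t i j)
  laplacian-offdiag {i} {j} i≢j = cong₂ _-_ (if-cong (dec-false (i ≟ j) i≢j)) (if-cong (dec-false (i ≟ j) i≢j))

  module LeafChildren (w : Pos t) where

    IsLeafChild : Fin (order t) → Set
    IsLeafChild a = LeafChildOf w (vertex t a)

    -- whether j is adjacent to the leaf children of w (other than j itself)
    adjToLeafChildren : Fin (order t) → Bool
    adjToLeafChildren j = isJoinPos (lca (parent (vertex t j)) w)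

    adjB-leafChild : ∀ {a} → IsLeafChild a → ∀ {j} → j ≢ a → adjB t j a ≡ adjToLeafChildren j
    adjB-leafChild {a} (leaf-a , parent-a) {j} j≢a = cong isJoinPos (begin
      lca (vertex t j) (vertex t a)                   ≡⟨ lca-distinct-leaves _ _ (vertex-leaf j) leaf-a (j≢a ∘ vertex-injective) ⟩
      lca (parent (vertex t j)) (parent (vertex t a)) ≡⟨ cong (lca (parent (vertex t j))) parent-a ⟩
      lca (parent (vertex t j)) w                     ∎)
      where open ≡-Reasoning

    adjB-leafChild′ : ∀ {a} → IsLeafChild a → ∀ {j} → j ≢ a → adjB t a j ≡ adjToLeafChildren j
    adjB-leafChild′ {a} a-child {j} j≢a =
      trans (cong isJoinPos (lca-comm (vertex t a) (vertex t j))) (adjB-leafChild a-child j≢a)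

    adjToLeafChildren-leafChild : ∀ {a} → IsLeafChild a → adjToLeafChildren a ≡ isJoinPos w
    adjToLeafChildren-leafChild (_ , parent-a) = cong isJoinPos (trans (cong (λ p → lca p w) parent-a) (lca-idem w))

    δ≡countᶠ : δ w ≡ countᶠ (order t) adjToLeafChildren
    δ≡countᶠ = trans (cong (length ∘ filterᵇ (λ v → isJoinPos (lca (parent v) w))) (sym tabulate-vertex))
                     (length-filterᵇ-tabulate (order t) _ (vertex t))

    degree-leafChild : ∀ {a} → IsLeafChild a →
      degreeG t a ≡ countᶠ (order t) (λ j → if does (a ≟ j) then false else adjToLeafChildren j)
    degree-leafChild {a} a-child = trans (length-filterᵇ-tabulate (order t) _ id) (countᶠ-cong (order t) agree)
      where
      agree : ∀ j → (if does (a ≟ j) then false else adjB t a j) ≡ (if does (a ≟ j) then false else adjToLeafChildren j)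
      agree j with a ≟ j
      ... | yes _   = refl
      ... | no  a≢j = adjB-leafChild′ a-child (a≢j ∘ sym)

    -- a leaf child a is counted in δ(w) exactly when w is of ⊗-type
    δ≡degree+isJoin : ∀ {a} → IsLeafChild a → δ w ≡ degreeG t a ℕ.+ boolToℕ (isJoinPos w)
    δ≡degree+isJoin {a} a-child = begin
      δ w                                   ≡⟨ δ≡countᶠ ⟩
      countᶠ (order t) adjToLeafChildren    ≡⟨ countᶠ-remove (order t) adjToLeafChildren a ⟩
      countᶠ (order t) (λ j → if does (a ≟ j) then false else adjToLeafChildren j) ℕ.+ boolToℕ (adjToLeafChildren a)
        ≡⟨ cong₂ ℕ._+_ (sym (degree-leafChild a-child)) (cong boolToℕ (adjToLeafChildren-leafChild a-child)) ⟩
      degreeG t a ℕ.+ boolToℕ (isJoinPos w) ∎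
      where open ≡-Reasoning

    laplacian-leafChildren : ∀ {a b} → IsLeafChild a → IsLeafChild b → a ≢ b →
                             laplacian t a a - laplacian t a b ≡ ℕtoℚ (δ w)
    laplacian-leafChildren {a} {b} a-child b-child a≢b = begin
      laplacian t a a - laplacian t a b
        ≡⟨ cong₂ _-_ (laplacian-diag a) (laplacian-offdiag a≢b) ⟩
      (ℕtoℚ (degreeG t a) - 0ℚ) - (0ℚ - adjEntry (adjB t a b))
        ≡⟨ solve 2 (λ d x → (d :- con 0ℚ) :- (con 0ℚ :- x) := d :+ x) refl (ℕtoℚ (degreeG t a)) _ ⟩
      ℕtoℚ (degreeG t a) + adjEntry (adjB t a b)
        ≡⟨ cong (λ x → ℕtoℚ (degreeG t a) + adjEntry x)
                (trans (adjB-leafChild b-child a≢b) (adjToLeafChildren-leafChild a-child)) ⟩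
      ℕtoℚ (degreeG t a) + adjEntry (isJoinPos w)
        ≡⟨ sym (trans (cong ℕtoℚ (δ≡degree+isJoin a-child)) (ℕtoℚ-+-boolToℕ (degreeG t a) (isJoinPos w))) ⟩
      ℕtoℚ (δ w) ∎
      where open ≡-Reasoning

    leafChildren-eigenTwins : ∀ {a b} → IsLeafChild a → IsLeafChild b → a ≢ b →
                              EigenTwins (laplacian t) (ℕtoℚ (δ w)) a b
    leafChildren-eigenTwins a-child b-child a≢b =
      laplacian-leafChildren a-child b-child a≢b ,
      laplacian-leafChildren b-child a-child (a≢b ∘ sym) ,
      λ i i≢a i≢b → trans (laplacian-offdiag i≢a)
                    (trans (cong (λ x → 0ℚ - adjEntry x) (trans (adjB-leafChild a-child i≢a) (sym (adjB-leafChild b-child i≢b))))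
                           (sym (laplacian-offdiag i≢b)))

    leafChildren-multiplicity : (as : List (Pos t)) → All (LeafChildOf w) as → Unique as →
                                EigenvalueMultAtLeast (laplacian t) (ℕtoℚ (δ w)) (length as ∸ 1)
    leafChildren-multiplicity []       _                          _ = (λ ()) , (λ ()) , (λ _ _ ())
    leafChildren-multiplicity (a ∷ as) (a-child ∷ as-children) (a∉as AllPairs.∷ as-unique) =
      multiplicity-from-eigenTwins (laplacian t) (ℕtoℚ (δ w)) (index a a-child) b b-injective b≢a
        (λ r → leafChildren-eigenTwins (index-leafChild a a-child) (index-leafChild _ (child r)) (b≢a r ∘ sym))
      where
      index : ∀ p → LeafChildOf w p → Fin (order t)
      index p (leaf-p , _) = vertexIndex p leaf-p

      vertex-index : ∀ p (p-child : LeafChildOf w p) → vertex t (index p p-child) ≡ p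
      vertex-index p (leaf-p , _) = vertex-vertexIndex p leaf-p

      index-leafChild : ∀ p (p-child : LeafChildOf w p) → IsLeafChild (index p p-child)
      index-leafChild p p-child = subst (LeafChildOf w) (sym (vertex-index p p-child)) p-child

      child : ∀ r → LeafChildOf w (lookup as r)
      child r = All.lookup as-children (∈-lookup r)

      b : Fin (length as) → Fin (order t)
      b r = index (lookup as r) (child r)

      vertex-b : ∀ r → vertex t (b r) ≡ lookup as r
      vertex-b r = vertex-index (lookup as r) (child r)

      b-injective : ∀ {r s} → b r ≡ b s → r ≡ s
      b-injective {r} {s} eq = lookup-injective as-unique r s (trans (sym (vertex-b r)) (trans (cong (vertex t) eq) (vertex-b s)))

      b≢a : ∀ r → b r ≢ index a a-child
      b≢a r eq = All.lookup a∉as (∈-lookup r) (trans (sym (vertex-index a a-child)) (trans (cong (vertex t) (sym eq)) (vertex-b r)))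

lemma3p1 : (T : Cotree) → Valid T →
    (w : Pos T) → IsInterior w →
    ((w' : Pos T) → IsInterior w' → depth w' ≤ depth w) →
    2 ≤ leafChildren w →
    EigenvalueMultAtLeast (laplacian T) (ℕtoℚ (δ w)) (leafChildren w ∸ 1)
lemma3p1 t _ w _ _ _ =
  subst (EigenvalueMultAtLeast (laplacian t) (ℕtoℚ (δ w))) (cong (_∸ 1) (length-leafChildrenOf w))
    (leafChildren-multiplicity (leafChildrenOf w) (leafChildrenOf-leafChild w) (leafChildrenOf-unique w))
  where open Cograph.LeafChildren t w
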